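{- Let $G$ be a graph that is curious with respect to a partition $(V_1,V_2,V_3)$, such that $G[V_1\cup V_2]$ and $G[V_1\cup V_3]$ are both $2P_2$-free. Then the vertices of $V_1$ admit a linear ordering which is decreasing in $G[V_1\cup V_2]$ and increasing in $G[V_1\cup V_3]$.
   Context: A graph $G$ is curious with respect to a partition $(V_1,V_2,V_3)$ of its vertex set into three (possibly empty) independent sets if there are no $x\in V_1$, $y\in V_2$, $z\in V_3$ such that $G[\{x,y,z\}]$ is a triangle or is edgeless. $2P_2$ is the disjoint union of two edges. For an independent set $I$ in a graph $H$, a linear order $(x_1,\dots,x_k)$ of $I$ is increasing in $H$ if $i<j$ implies $N_H(x_i)\subseteq N_H(x_j)$, and decreasing in $H$ if $i<j$ implies $N_H(x_i)\supseteq N_H(x_j)$. -}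

module Defs where

open import Data.Nat using (ℕ)
open import Data.Fin using (Fin; zero; suc; _<_)
open import Data.Bool using (Bool; true; false)
open import Data.Product using (_×_; Σ; _,_)
open import Data.Sum using (_⊎_)
open import Data.List using (List; length; lookup)
open import Data.List.Membership.Propositional using (_∈_)
open import Data.List.Relation.Unary.Unique.Propositional using (Unique)
open import Relation.Binary.PropositionalEquality using (_≡_; _≢_)
open import Relation.Nullary using (¬_)
open import Data.Empty using (⊥)
open import Function.Bundles using (_⇔_)

record Graph (n : ℕ) : Set where
  field
    adj   : Fin n → Fin n → Bool
    sym   : ∀ x y → adj x y ≡ adj y x
    irrefl : ∀ x → adj x x ≡ false

open Graph public

Edge : ∀ {n} → Graph n → Fin n → Fin n → Set
Edge G x y = adj G x y ≡ true

NonEdge : ∀ {n} → Graph n → Fin n → Fin n → Set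
NonEdge G x y = adj G x y ≡ false

-- A partition (V₁,V₂,V₃) of the vertex set: each vertex gets a label in Fin 3
-- (label 0 ↦ V₁, 1 ↦ V₂, 2 ↦ V₃). Parts may be empty.
Partition : ℕ → Set
Partition n = Fin n → Fin 3

V₁ V₂ V₃ : Fin 3
V₁ = zero
V₂ = suc zero
V₃ = suc (suc zero)

In : ∀ {n} → Partition n → Fin 3 → Fin n → Set
In p i x = p x ≡ i

PartsIndependent : ∀ {n} → Graph n → Partition n → Set
PartsIndependent G p = ∀ x y → p x ≡ p y → NonEdge G x y

Curious : ∀ {n} → Graph n → Partition n → Set
Curious G p =
  PartsIndependent G p ×
  (∀ x y z → In p V₁ x → In p V₂ y → In p V₃ z →
     ¬ (Edge G x y × Edge G y z × Edge G x z) ×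
     ¬ (NonEdge G x y × NonEdge G y z × NonEdge G x z))

VSet : ℕ → Set₁
VSet n = Fin n → Set

_∪_ : ∀ {n} → VSet n → VSet n → VSet n
(A ∪ B) x = A x ⊎ B x

TwoP₂Free : ∀ {n} → Graph n → VSet n → Set
TwoP₂Free G S =
  ∀ a b c d → S a → S b → S c → S d →
  a ≢ b → a ≢ c → a ≢ d → b ≢ c → b ≢ d → c ≢ d →
  Edge G a b → Edge G c d →
  NonEdge G a c → NonEdge G a d → NonEdge G b c → NonEdge G b d → ⊥

NbrIn : ∀ {n} → Graph n → VSet n → Fin n → Fin n → Set
NbrIn G S x y = S y × Edge G x y

NSub : ∀ {n} → Graph n → VSet n → Fin n → Fin n → Set
NSub G S x y = ∀ z → NbrIn G S x z → NbrIn G S y z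

LinearOrderOf : ∀ {n} → VSet n → List (Fin n) → Set
LinearOrderOf I xs = Unique xs × (∀ x → (x ∈ xs) ⇔ I x)

Increasing : ∀ {n} → Graph n → VSet n → List (Fin n) → Set
Increasing G S xs = ∀ (i j : Fin (length xs)) → i < j →
  NSub G S (lookup xs i) (lookup xs j)

Decreasing : ∀ {n} → Graph n → VSet n → List (Fin n) → Set
Decreasing G S xs = ∀ (i j : Fin (length xs)) → i < j →
  NSub G S (lookup xs j) (lookup xs i)

-- For x, y ∈ V₁ let x ⊑ y mean N₂(y) ⊆ N₂(x) and N₃(x) ⊆ N₃(y), where Nᵢ is the
-- neighbourhood in G[V₁ ∪ Vᵢ]. Since V₁ and Vᵢ are independent, 2P₂-freeness
-- makes the neighbourhoods Nᵢ(x), x ∈ V₁, pairwise nested. Curiosity links the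
-- two sides: a vertex w ∈ V₂ adjacent to x but not to y forces N₃(x) ⊆ N₃(y),
-- since any z ∈ N₃(x) ∖ N₃(y) would make {x,w,z} a triangle or {y,w,z} edgeless.
-- Hence ⊑ is a total preorder on V₁, and sorting V₁ by it gives the ordering.
module Submission where

open import Defs
open import Level using (_⊔_; 0ℓ)
open import Data.Nat using (ℕ)
open import Data.Nat.Properties using (<⇒≤)
open import Data.Fin using (Fin; _<_)
open import Data.Fin.Properties using (all?; ¬∀⟶∃¬) renaming (_≟_ to _≟F_)
open import Data.Bool using (true; false)
open import Data.Bool.Properties using () renaming (_≟_ to _≟B_)
open import Data.Product using (Σ; ∃; _×_; _,_; proj₁; proj₂)
open import Data.Sum using (_⊎_; inj₁; inj₂)
open import Data.Empty using (⊥-elim)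
open import Data.List using (List; filter; allFin; lookup)
open import Data.List.Membership.Propositional.Properties using (∈-allFin; ∈-filter⁺; ∈-filter⁻; ∈-lookup)
open import Data.List.Relation.Unary.Unique.Propositional.Properties using (allFin⁺; filter⁺)
open import Data.List.Relation.Binary.Permutation.Propositional using (↭-sym; ↭⇒↭ₛ)
open import Data.List.Relation.Binary.Permutation.Propositional.Properties using (∈-resp-↭)
import Data.List.Relation.Binary.Permutation.Setoid.Properties as Permutationₛ
import Data.List.Sort as Sort
open import Data.List.Relation.Unary.Sorted.TotalOrder.Properties using (lookup-mono-≤)
open import Relation.Nullary using (¬_; yes; no)
open import Relation.Nullary.Decidable using (_×-dec_; _⊎-dec_; _→-dec_)
open import Relation.Unary using (Pred) renaming (Decidable to Decidable₁)
open import Relation.Binary using (Rel; Reflexive; Transitive; Decidable; DecTotalOrder)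
import Relation.Binary.Construct.Interior.Symmetric as SymInterior
open import Relation.Binary.PropositionalEquality using (_≢_; refl; trans; ≢-sym; setoid) renaming (sym to ≡-sym)
open import Function.Bundles using (mk⇔; Equivalence)

-- The library sort needs a total order on the whole carrier, so a preorder that is
-- only total on P is extended by placing every element outside P on top.
module OutsideOnTop {a p ℓ} {A : Set a} (P : Pred A p) (_≲_ : Rel A ℓ) where

  _≲⁺_ : Rel A (p ⊔ ℓ)
  x ≲⁺ y = P y → P x × x ≲ y

  decTotalOrder : Decidable₁ P → Reflexive _≲_ → Transitive _≲_ →
                  (∀ {x y} → P x → P y → x ≲ y ⊎ y ≲ x) → Decidable _≲_ →
                  DecTotalOrder a (p ⊔ ℓ) (p ⊔ ℓ)
  decTotalOrder P? ≲-refl ≲-trans ≲-total _≲?_ = record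
    { isDecTotalOrder = record
      { isTotalOrder = record
        { isPartialOrder = SymInterior.isPartialOrder ≲⁺-refl ≲⁺-trans
        ; total          = ≲⁺-total
        }
      ; _≟_  = SymInterior.decidable _≲⁺?_
      ; _≤?_ = _≲⁺?_
      }
    }
    where
    ≲⁺-refl : Reflexive _≲⁺_
    ≲⁺-refl Px = Px , ≲-refl

    ≲⁺-trans : Transitive _≲⁺_
    ≲⁺-trans x≲⁺y y≲⁺z Pz with y≲⁺z Pz
    ... | Py , y≲z with x≲⁺y Py
    ...   | Px , x≲y = Px , ≲-trans x≲y y≲z

    ≲⁺-total : ∀ x y → x ≲⁺ y ⊎ y ≲⁺ x
    ≲⁺-total x y with P? x | P? y
    ... | no ¬Px | _      = inj₂ λ Px → ⊥-elim (¬Px Px)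
    ... | yes _  | no ¬Py = inj₁ λ Py → ⊥-elim (¬Py Py)
    ... | yes Px | yes Py with ≲-total Px Py
    ...   | inj₁ x≲y = inj₁ λ _ → Px , x≲y
    ...   | inj₂ y≲x = inj₂ λ _ → Py , y≲x

    _≲⁺?_ : Decidable _≲⁺_
    x ≲⁺? y = P? y →-dec (P? x ×-dec (x ≲? y))

module _ {n : ℕ} (G : Graph n) where

  Edge⇒¬NonEdge : ∀ {x y} → Edge G x y → ¬ NonEdge G x y
  Edge⇒¬NonEdge exy nxy with () ← trans (≡-sym exy) nxy

  Edge⇒≢ : ∀ {x y} → Edge G x y → x ≢ y
  Edge⇒≢ {x} exy refl = Edge⇒¬NonEdge exy (irrefl G x)

  Edge-NonEdge⇒≢ : ∀ {x y z} → Edge G x z → NonEdge G y z → x ≢ y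
  Edge-NonEdge⇒≢ exz nxz refl = Edge⇒¬NonEdge exz nxz

  Edge-sym : ∀ {x y} → Edge G x y → Edge G y x
  Edge-sym {x} {y} exy = trans (Graph.sym G y x) exy

  NonEdge-sym : ∀ {x y} → NonEdge G x y → NonEdge G y x
  NonEdge-sym {x} {y} nxy = trans (Graph.sym G y x) nxy

  Edge-or-NonEdge : ∀ x y → Edge G x y ⊎ NonEdge G x y
  Edge-or-NonEdge x y with adj G x y
  ... | true  = inj₁ refl
  ... | false = inj₂ refl

  PrivateNbr : VSet n → Fin n → Fin n → Fin n → Set
  PrivateNbr S x y w = NbrIn G S x w × NonEdge G y w

  module _ {S : VSet n} (S? : Decidable₁ S) where

    NbrIn? : Decidable (NbrIn G S)
    NbrIn? x z = S? z ×-dec (adj G x z ≟B true)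

    NSub? : Decidable (NSub G S)
    NSub? x y = all? λ z → NbrIn? x z →-dec NbrIn? y z

    ¬NSub⇒PrivateNbr : ∀ {x y} → ¬ NSub G S x y → ∃ (PrivateNbr S x y)
    ¬NSub⇒PrivateNbr {x} {y} ¬x⊆y
      with w , ¬w ← ¬∀⟶∃¬ n _ (λ z → NbrIn? x z →-dec NbrIn? y z) ¬x⊆y
      with NbrIn? x w
    ... | no ¬xw = ⊥-elim (¬w λ xw → ⊥-elim (¬xw xw))
    ... | yes (Sw , exw) with Edge-or-NonEdge y w
    ...   | inj₁ eyw = ⊥-elim (¬w λ _ → Sw , eyw)
    ...   | inj₂ nyw = w , (Sw , exw) , nyw

  module Independent (p : Partition n) (indep : PartsIndependent G p) where

    In? : ∀ i → Decidable₁ (In p i)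
    In? i x = p x ≟F i

    NonEdge-within : ∀ {i x y} → In p i x → In p i y → NonEdge G x y
    NonEdge-within {x = x} {y} xi yi = indep x y (trans xi (≡-sym yi))

    NbrIn⇒other-part : ∀ {i j x w} → In p i x → NbrIn G (In p i ∪ In p j) x w → In p j w
    NbrIn⇒other-part xi (inj₁ wi , exw) = ⊥-elim (Edge⇒¬NonEdge exw (NonEdge-within xi wi))
    NbrIn⇒other-part xi (inj₂ wj , _)   = wj

    PrivateNbr⇒NSub-reverse : ∀ {i j} → TwoP₂Free G (In p i ∪ In p j) →
      ∀ {x y w} → In p i x → In p i y → PrivateNbr (In p i ∪ In p j) x y w →
      NSub G (In p i ∪ In p j) y x
    PrivateNbr⇒NSub-reverse free {x} {y} {w} xi yi ((Sw , exw) , nyw) z (Sz , eyz)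
      with Edge-or-NonEdge x z
    ... | inj₁ exz = Sz , exz
    -- otherwise the edges xw and yz induce a 2P₂
    ... | inj₂ nxz = ⊥-elim (free x w y z (inj₁ xi) Sw (inj₁ yi) Sz
            (Edge⇒≢ exw) (Edge-NonEdge⇒≢ exw nyw) x≢z w≢y w≢z (Edge⇒≢ eyz)
            exw eyz nxy nxz (NonEdge-sym nyw) nwz)
      where
      nxy : NonEdge G x y
      nxy = NonEdge-within xi yi
      nwz : NonEdge G w z
      nwz = NonEdge-within (NbrIn⇒other-part xi (Sw , exw)) (NbrIn⇒other-part yi (Sz , eyz))
      x≢z : x ≢ z
      x≢z = ≢-sym (Edge-NonEdge⇒≢ (Edge-sym eyz) nxy)
      w≢y : w ≢ y
      w≢y = Edge-NonEdge⇒≢ (Edge-sym exw) (NonEdge-sym nxy)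
      w≢z : w ≢ z
      w≢z = Edge-NonEdge⇒≢ (Edge-sym exw) (NonEdge-sym nxz)

  module _ (p : Partition n) (cur : Curious G p) where

    open Independent p (proj₁ cur)

    PrivateNbr₂⇒NSub₃ : ∀ {x y w} → In p V₁ x → In p V₁ y →
      PrivateNbr (In p V₁ ∪ In p V₂) x y w → NSub G (In p V₁ ∪ In p V₃) x y
    PrivateNbr₂⇒NSub₃ {x} {y} {w} x₁ y₁ ((Sw , exw) , nyw) z (Sz , exz) =
      by-cases (Edge-or-NonEdge w z) (Edge-or-NonEdge y z)
      where
      w₂ : In p V₂ w
      w₂ = NbrIn⇒other-part x₁ (Sw , exw)
      z₃ : In p V₃ z
      z₃ = NbrIn⇒other-part x₁ (Sz , exz)
      by-cases : Edge G w z ⊎ NonEdge G w z → Edge G y z ⊎ NonEdge G y z →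
                 NbrIn G (In p V₁ ∪ In p V₃) y z
      by-cases (inj₁ ewz) _          = ⊥-elim (proj₁ (proj₂ cur x w z x₁ w₂ z₃) (exw , ewz , exz))
      by-cases (inj₂ _)   (inj₁ eyz) = Sz , eyz
      by-cases (inj₂ nwz) (inj₂ nyz) = ⊥-elim (proj₂ (proj₂ cur y w z y₁ w₂ z₃) (nyw , nwz , nyz))

  module SortV₁ (p : Partition n) (cur : Curious G p)
                (free₂ : TwoP₂Free G (In p V₁ ∪ In p V₂))
                (free₃ : TwoP₂Free G (In p V₁ ∪ In p V₃)) where

    open Independent p (proj₁ cur)

    S₂ S₃ : VSet n
    S₂ = In p V₁ ∪ In p V₂
    S₃ = In p V₁ ∪ In p V₃

    S? : ∀ i → Decidable₁ (In p V₁ ∪ In p i)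
    S? i x = In? V₁ x ⊎-dec In? i x

    _⊑_ : Rel (Fin n) 0ℓ
    x ⊑ y = NSub G S₂ y x × NSub G S₃ x y

    ⊑-refl : Reflexive _⊑_
    ⊑-refl = (λ _ z∈N → z∈N) , (λ _ z∈N → z∈N)

    ⊑-trans : Transitive _⊑_
    ⊑-trans (y₂⊆x₂ , x₃⊆y₃) (z₂⊆y₂ , y₃⊆z₃) =
      (λ u z∈N → y₂⊆x₂ u (z₂⊆y₂ u z∈N)) , (λ u x∈N → y₃⊆z₃ u (x₃⊆y₃ u x∈N))

    _⊑?_ : Decidable _⊑_
    x ⊑? y = NSub? (S? V₂) y x ×-dec NSub? (S? V₃) x y

    PrivateNbr₂⇒⊑ : ∀ {x y w} → In p V₁ x → In p V₁ y → PrivateNbr S₂ x y w → x ⊑ y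
    PrivateNbr₂⇒⊑ x₁ y₁ private₂ =
      PrivateNbr⇒NSub-reverse free₂ x₁ y₁ private₂ , PrivateNbr₂⇒NSub₃ p cur x₁ y₁ private₂

    ⊑-total : ∀ {x y} → In p V₁ x → In p V₁ y → x ⊑ y ⊎ y ⊑ x
    ⊑-total {x} {y} x₁ y₁ with NSub? (S? V₂) x y | NSub? (S? V₂) y x
    ... | no x₂⊈y₂ | _        = inj₁ (PrivateNbr₂⇒⊑ x₁ y₁ (proj₂ (¬NSub⇒PrivateNbr (S? V₂) x₂⊈y₂)))
    ... | yes _    | no y₂⊈x₂ = inj₂ (PrivateNbr₂⇒⊑ y₁ x₁ (proj₂ (¬NSub⇒PrivateNbr (S? V₂) y₂⊈x₂)))
    ... | yes x₂⊆y₂ | yes y₂⊆x₂ with NSub? (S? V₃) x y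
    ...   | yes x₃⊆y₃ = inj₁ (y₂⊆x₂ , x₃⊆y₃)
    ...   | no x₃⊈y₃  = inj₂ (x₂⊆y₂ , PrivateNbr⇒NSub-reverse free₃ x₁ y₁
                                         (proj₂ (¬NSub⇒PrivateNbr (S? V₃) x₃⊈y₃)))

    order : DecTotalOrder _ _ _
    order = OutsideOnTop.decTotalOrder (In p V₁) _⊑_ (In? V₁) ⊑-refl ⊑-trans ⊑-total _⊑?_

    open Sort order using (sort; sort-↭; sort-↗)

    V₁-list : List (Fin n)
    V₁-list = filter (In? V₁) (allFin n)

    sortedV₁ : List (Fin n)
    sortedV₁ = sort V₁-list

    sortedV₁-linearOrder : LinearOrderOf (In p V₁) sortedV₁
    sortedV₁-linearOrder =
      Permutationₛ.Unique-resp-↭ (setoid (Fin n)) (↭⇒↭ₛ (↭-sym (sort-↭ V₁-list)))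
        (filter⁺ (In? V₁) (allFin⁺ n)) ,
      λ x → mk⇔ (λ x∈ → proj₂ (∈-filter⁻ (In? V₁) {xs = allFin n} (∈-resp-↭ (sort-↭ V₁-list) x∈)))
                (λ x₁ → ∈-resp-↭ (↭-sym (sort-↭ V₁-list)) (∈-filter⁺ (In? V₁) (∈-allFin x) x₁))

    sortedV₁-⊑ : ∀ i j → i < j → lookup sortedV₁ i ⊑ lookup sortedV₁ j
    sortedV₁-⊑ i j i<j =
      proj₂ (lookup-mono-≤ (DecTotalOrder.totalOrder order) (sort-↗ V₁-list) (<⇒≤ i<j) lookup-j₁)
      where
      lookup-j₁ : In p V₁ (lookup sortedV₁ j)
      lookup-j₁ = Equivalence.to (proj₂ sortedV₁-linearOrder _) (∈-lookup j)

lemma11 : {n : ℕ} (G : Graph n) (p : Partition n) →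
    Curious G p →
    TwoP₂Free G (In p V₁ ∪ In p V₂) →
    TwoP₂Free G (In p V₁ ∪ In p V₃) →
    Σ (List (Fin n)) λ xs →
    LinearOrderOf (In p V₁) xs ×
    Decreasing G (In p V₁ ∪ In p V₂) xs ×
    Increasing G (In p V₁ ∪ In p V₃) xs
lemma11 G p cur free₂ free₃ =
  sortedV₁ ,
  sortedV₁-linearOrder ,
  (λ i j i<j → proj₁ (sortedV₁-⊑ i j i<j)) ,
  (λ i j i<j → proj₂ (sortedV₁-⊑ i j i<j))
  where open SortV₁ G p cur free₂ free₃
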